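{- Let $n\ge4$ be even, let $U$ be as in the context, and let $y=\big(1,\frac{n-2}{3(n-1)}\mathbf{1}_{n-1}',-\frac{n+1}{3(n-1)}\mathbf{1}_{n-1}'\big)'$. Then $U^\dagger y=\frac{2n-1}{n+4}y$.
   Context: $\mathbf{1}_p$ all-ones vector in $\mathbb{R}^p$, $J_p=\mathbf{1}_p\mathbf{1}_p'$, $I_p$ identity, $X'$ transpose, $X^\dagger$ Moore–Penrose inverse. $\mathrm{Circ}(a_1,\dots,a_p)$ is the circulant matrix with first row $(a_1,\dots,a_p)$, each subsequent row the previous one shifted cyclically one position to the right. $S=\mathrm{Circ}(1,3,\dots,3,1)$ (size $n-1$, $n-3$ threes), $T=\mathrm{Circ}(0,2,4,\dots,4,2)$ (size $n-1$, $n-4$ fours), \[D=\begin{bmatrix}0&\mathbf{1}_{n-1}'&2\mathbf{1}_{n-1}'\\ \mathbf{1}_{n-1}&2(J_{n-1}-I_{n-1})&S\\ 2\mathbf{1}_{n-1}&S'&T\end{bmatrix}\] (distance matrix of the gear graph on $2n-1$ vertices), $P=I_{2n-1}-\frac{1}{2n-1}J_{2n-1}$, $U=-\frac12PDP$. -}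

module Defs where

open import Data.Nat as ℕ using (ℕ; zero; suc; _∸_; _≤ᵇ_; _≡ᵇ_; _<ᵇ_)
open import Data.Bool using (Bool; true; false; if_then_else_)
open import Data.Integer as ℤ using (ℤ; +_)
open import Data.Rational as ℚ using (ℚ; 0ℚ; 1ℚ; _+_; _*_; _-_; -_)
open import Data.Fin using (Fin; toℕ)
open import Relation.Binary.PropositionalEquality using (_≡_)

-- Rational a/d; the zero-denominator case is never used below (all
-- denominators are positive when n ≥ 4).
frac : ℤ → ℕ → ℚ
frac a zero    = 0ℚ
frac a (suc d) = a ℚ./ suc d

nat : ℕ → ℚ
nat k = frac (+ k) 1

Mat : ℕ → ℕ → Set
Mat m k = Fin m → Fin k → ℚ

Vec' : ℕ → Set
Vec' m = Fin m → ℚ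

sumFin : ∀ {m} → (Fin m → ℚ) → ℚ
sumFin {zero}  f = 0ℚ
sumFin {suc m} f = f Fin.zero + sumFin (λ i → f (Fin.suc i))
  where import Data.Fin as Fin

_⊗_ : ∀ {a b c} → Mat a b → Mat b c → Mat a c
(A ⊗ B) i j = sumFin (λ k → A i k * B k j)

_·_ : ∀ {a b} → Mat a b → Vec' b → Vec' a
(A · v) i = sumFin (λ k → A i k * v k)

transpose : ∀ {a b} → Mat a b → Mat b a
transpose A i j = A j i

MatEq : ∀ {a b} → Mat a b → Mat a b → Set
MatEq A B = ∀ i j → A i j ≡ B i j

-- X is the Moore–Penrose inverse of A (the four Penrose conditions);
-- it is unique, so "A† = X" means exactly IsMoorePenrose A X.
record IsMoorePenrose {a b : ℕ} (A : Mat a b) (X : Mat b a) : Set where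
  field
    penrose₁ : MatEq ((A ⊗ X) ⊗ A) A
    penrose₂ : MatEq ((X ⊗ A) ⊗ X) X
    penrose₃ : MatEq (transpose (A ⊗ X)) (A ⊗ X)
    penrose₄ : MatEq (transpose (X ⊗ A)) (X ⊗ A)

-- Circulant offset: for 0 ≤ i, j < p, the 0-based position in the first
-- row of Circ(a_1..a_p) giving entry (i,j), i.e. (j - i) mod p.
circOff : ℕ → ℕ → ℕ → ℕ
circOff p i j = if i ≤ᵇ j then j ∸ i else (j ℕ.+ p) ∸ i

-- First rows (0-based positions), size p = n-1:
-- S = Circ(1,3,…,3,1),  T = Circ(0,2,4,…,4,2)
sRow : ℕ → ℕ → ℚ
sRow n d = if d ≡ᵇ 0 then nat 1 else if d ≡ᵇ (n ∸ 2) then nat 1 else nat 3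

tRow : ℕ → ℕ → ℚ
tRow n d = if d ≡ᵇ 0 then nat 0 else if d ≡ᵇ 1 then nat 2
           else if d ≡ᵇ (n ∸ 2) then nat 2 else nat 4

Sₑ : ℕ → ℕ → ℕ → ℚ
Sₑ n i j = sRow n (circOff (n ∸ 1) i j)

Tₑ : ℕ → ℕ → ℕ → ℚ
Tₑ n i j = tRow n (circOff (n ∸ 1) i j)

-- Entries of the block matrix D (0-based indices in 0..2n-2):
-- index 0 = first block row/column, 1..n-1 = second, n..2n-2 = third.
Dₑ : ℕ → ℕ → ℕ → ℚ
Dₑ n zero zero = nat 0
Dₑ n zero (suc b) = if suc b <ᵇ n then nat 1 else nat 2
Dₑ n (suc a) zero = if suc a <ᵇ n then nat 1 else nat 2
Dₑ n (suc a) (suc b) =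
  if suc a <ᵇ n
  then (if suc b <ᵇ n
        then (if a ≡ᵇ b then nat 0 else nat 2)
        else Sₑ n a (suc b ∸ n))
  else (if suc b <ᵇ n
        then Sₑ n b (suc a ∸ n)
        else Tₑ n (suc a ∸ n) (suc b ∸ n))

dim : ℕ → ℕ
dim n = 2 ℕ.* n ∸ 1

D : (n : ℕ) → Mat (dim n) (dim n)
D n i j = Dₑ n (toℕ i) (toℕ j)

idM : ∀ {m} → Mat m m
idM i j = if toℕ i ≡ᵇ toℕ j then 1ℚ else 0ℚ

P : (n : ℕ) → Mat (dim n) (dim n)
P n i j = idM i j - frac (+ 1) (dim n)

U : (n : ℕ) → Mat (dim n) (dim n)
U n i j = (- frac (+ 1) 2) * ((P n ⊗ D n) ⊗ P n) i j

y : (n : ℕ) → Vec' (dim n)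
y n i with toℕ i
... | zero  = 1ℚ
... | suc a = if suc a <ᵇ n
              then frac (+ (n ∸ 2)) (3 ℕ.* (n ∸ 1))
              else - frac (+ (n ℕ.+ 1)) (3 ℕ.* (n ∸ 1))

{-# OPTIONS --safe #-}
-- The distance matrix D of the gear graph maps vectors that are constant on the three vertex
-- classes (the hub, its n - 1 neighbours, the n - 1 vertices of degree 2) to such vectors, through
-- a 3 × 3 quotient matrix.  On that quotient one checks that κ D y = -2 y + c 𝟙 for
-- κ = (2n - 1)/(n + 4) and a constant c.  As 𝟙'y = 0, the centring matrix P fixes y and
-- annihilates 𝟙, hence U (κ y) = -½ P D P (κ y) = y.  Finally, for a symmetric A with
-- Moore–Penrose inverse X, A (κ y) = y forces X y = κ y: the Penrose conditions make X A and
-- A X symmetric, which lets X be moved past A.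
module Submission where

module GearDistance where

  open import Defs
  open import Data.Nat as ℕ using (ℕ; zero; suc)
  import Data.Nat.Properties as ℕ
  open import Data.Fin using (Fin; zero; suc; toℕ)
  open import Data.Fin.Properties using (toℕ<n)
  import Data.Integer as ℤ
  import Data.Integer.Properties as ℤ
  open import Data.Rational using (ℚ; 0ℚ; 1ℚ; _+_; _*_; _-_; -_; toℚᵘ)
  open import Data.Rational.Properties
  open import Data.Rational.Unnormalised as ℚᵘ using (mkℚᵘ; *≡*) renaming (_≃_ to _≃ᵘ_)
  import Data.Rational.Unnormalised.Properties as ℚᵘ
  open import Algebra.Bundles using (CommutativeMonoid)
  open import Algebra.Properties.CommutativeSemigroup
    (CommutativeMonoid.commutativeSemigroup +-0-commutativeMonoid)
    using () renaming (interchange to +-interchange)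
  open import Algebra.Properties.CommutativeSemigroup
    (CommutativeMonoid.commutativeSemigroup *-1-commutativeMonoid)
    using () renaming (x∙yz≈y∙xz to *-left-comm; x∙yz≈y∙zx to *-rotate;
                xy∙z≈y∙xz to *-xy∙z≈y∙xz; x∙yz≈yx∙z to *-x∙yz≈yx∙z)
  open import Data.Bool using (true; false; if_then_else_)
  open import Data.Bool.Properties using (T-≡; ¬-not; if-cong; if-float)
  open import Data.Product using (_,_)
  open import Relation.Nullary using (yes; no)
  open import Relation.Binary.Definitions using (tri<; tri≈; tri>)
  open import Function.Bundles using (Equivalence)
  open import Function using (_∘_)
  open import Tactic.RingSolver using (solve-∀)
  open import Tactic.RingSolver.Core.AlmostCommutativeRing using (AlmostCommutativeRing; fromCommutativeRing)
  open import Relation.Nullary.Decidable.Core using (dec⇒maybe)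
  open import Level using (0ℓ)
  open import Data.Nat.Tactic.RingSolver using () renaming (solve-∀ to ℕ-solve-∀)
  open import Relation.Binary.PropositionalEquality

  ℚ-ring : AlmostCommutativeRing 0ℓ 0ℓ
  ℚ-ring = fromCommutativeRing +-*-commutativeRing (λ x → dec⇒maybe (0ℚ ≟ x))

  frac≃mkℚᵘ : ∀ a d → toℚᵘ (frac a (suc d)) ≃ᵘ mkℚᵘ a d
  frac≃mkℚᵘ a d = toℚᵘ-fromℚᵘ (mkℚᵘ a d)

  nat-+ : ∀ a b → nat (a ℕ.+ b) ≡ nat a + nat b
  nat-+ a b = toℚᵘ-injective (begin
    toℚᵘ (nat (a ℕ.+ b))                ≈⟨ frac≃mkℚᵘ (ℤ.+ (a ℕ.+ b)) 0 ⟩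
    mkℚᵘ (ℤ.+ (a ℕ.+ b)) 0              ≈⟨ *≡* (cong (ℤ._* ℤ.+ 1) ℤ-sum) ⟨
    mkℚᵘ (ℤ.+ a) 0 ℚᵘ.+ mkℚᵘ (ℤ.+ b) 0  ≈⟨ ℚᵘ.+-cong (frac≃mkℚᵘ (ℤ.+ a) 0) (frac≃mkℚᵘ (ℤ.+ b) 0) ⟨
    toℚᵘ (nat a) ℚᵘ.+ toℚᵘ (nat b)      ≈⟨ toℚᵘ-homo-+ (nat a) (nat b) ⟨
    toℚᵘ (nat a + nat b)                ∎)
    where
    open ℚᵘ.≃-Reasoning
    ℤ-sum : ℤ.+ a ℤ.* ℤ.+ 1 ℤ.+ ℤ.+ b ℤ.* ℤ.+ 1 ≡ ℤ.+ (a ℕ.+ b)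
    ℤ-sum = trans (cong₂ ℤ._+_ (ℤ.*-identityʳ (ℤ.+ a)) (ℤ.*-identityʳ (ℤ.+ b))) (sym (ℤ.pos-+ a b))

  nat-* : ∀ a b → nat (a ℕ.* b) ≡ nat a * nat b
  nat-* a b = toℚᵘ-injective (begin
    toℚᵘ (nat (a ℕ.* b))                ≈⟨ frac≃mkℚᵘ (ℤ.+ (a ℕ.* b)) 0 ⟩
    mkℚᵘ (ℤ.+ (a ℕ.* b)) 0              ≈⟨ *≡* (cong (ℤ._* ℤ.+ 1) (sym (ℤ.pos-* a b))) ⟨
    mkℚᵘ (ℤ.+ a) 0 ℚᵘ.* mkℚᵘ (ℤ.+ b) 0  ≈⟨ ℚᵘ.*-cong (frac≃mkℚᵘ (ℤ.+ a) 0) (frac≃mkℚᵘ (ℤ.+ b) 0) ⟨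
    toℚᵘ (nat a) ℚᵘ.* toℚᵘ (nat b)      ≈⟨ toℚᵘ-homo-* (nat a) (nat b) ⟨
    toℚᵘ (nat a * nat b)                ∎)
    where open ℚᵘ.≃-Reasoning

  frac-split : ∀ a d → frac (ℤ.+ a) (suc d) ≡ nat a * frac (ℤ.+ 1) (suc d)
  frac-split a d = toℚᵘ-injective (begin
    toℚᵘ (frac (ℤ.+ a) (suc d))          ≈⟨ frac≃mkℚᵘ (ℤ.+ a) d ⟩
    mkℚᵘ (ℤ.+ a) d                       ≈⟨ *≡* ℤ-cross ⟨
    mkℚᵘ (ℤ.+ a) 0 ℚᵘ.* mkℚᵘ (ℤ.+ 1) d   ≈⟨ ℚᵘ.*-cong (frac≃mkℚᵘ (ℤ.+ a) 0) (frac≃mkℚᵘ (ℤ.+ 1) d) ⟨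
    toℚᵘ (nat a) ℚᵘ.* toℚᵘ (frac (ℤ.+ 1) (suc d))  ≈⟨ toℚᵘ-homo-* (nat a) (frac (ℤ.+ 1) (suc d)) ⟨
    toℚᵘ (nat a * frac (ℤ.+ 1) (suc d))  ∎)
    where
    open ℚᵘ.≃-Reasoning
    ℤ-cross : ℤ.+ a ℤ.* ℤ.+ 1 ℤ.* ℤ.+ suc d ≡ ℤ.+ a ℤ.* ℤ.+ (1 ℕ.* suc d)
    ℤ-cross = trans (cong (ℤ._* ℤ.+ suc d) (ℤ.*-identityʳ (ℤ.+ a))) (cong (λ k → ℤ.+ a ℤ.* ℤ.+ k) (sym (ℕ.*-identityˡ (suc d))))

  frac-self : ∀ d → frac (ℤ.+ suc d) (suc d) ≡ 1ℚ
  frac-self d = toℚᵘ-injective (ℚᵘ.≃-trans (frac≃mkℚᵘ (ℤ.+ suc d) d) (*≡* (ℤ.*-comm (ℤ.+ suc d) (ℤ.+ 1))))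

  nat*frac≡1 : ∀ d → nat (suc d) * frac (ℤ.+ 1) (suc d) ≡ 1ℚ
  nat*frac≡1 d = trans (sym (frac-split (suc d) d)) (frac-self d)

  ≡ᵇ-comm : ∀ a b → (a ℕ.≡ᵇ b) ≡ (b ℕ.≡ᵇ a)
  ≡ᵇ-comm zero    zero    = refl
  ≡ᵇ-comm zero    (suc b) = refl
  ≡ᵇ-comm (suc a) zero    = refl
  ≡ᵇ-comm (suc a) (suc b) = ≡ᵇ-comm a b

  ≡ᵇ-true : ∀ a → (a ℕ.≡ᵇ a) ≡ true
  ≡ᵇ-true a = Equivalence.to T-≡ (ℕ.≡⇒≡ᵇ a a refl)

  ≡ᵇ-false : ∀ {a b} → a ≢ b → (a ℕ.≡ᵇ b) ≡ false
  ≡ᵇ-false {a} {b} a≢b = ¬-not (a≢b ∘ ℕ.≡ᵇ⇒≡ a b ∘ Equivalence.from T-≡)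

  <ᵇ-true : ∀ {a b} → a ℕ.< b → (a ℕ.<ᵇ b) ≡ true
  <ᵇ-true a<b = Equivalence.to T-≡ (ℕ.<⇒<ᵇ a<b)

  <ᵇ-false : ∀ {a b} → b ℕ.≤ a → (a ℕ.<ᵇ b) ≡ false
  <ᵇ-false {a} {b} b≤a = ¬-not (ℕ.≤⇒≯ b≤a ∘ ℕ.<ᵇ⇒< a b ∘ Equivalence.from T-≡)

  ≤ᵇ-true : ∀ {a b} → a ℕ.≤ b → (a ℕ.≤ᵇ b) ≡ true
  ≤ᵇ-true a≤b = Equivalence.to T-≡ (ℕ.≤⇒≤ᵇ a≤b)

  ≤ᵇ-false : ∀ {a b} → b ℕ.< a → (a ℕ.≤ᵇ b) ≡ false
  ≤ᵇ-false {a} {b} b<a = ¬-not (ℕ.<⇒≱ b<a ∘ ℕ.≤ᵇ⇒≤ a b ∘ Equivalence.from T-≡)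

  infixr 7 _•_
  _•_ : ∀ {m} → ℚ → Vec' m → Vec' m
  (c • v) i = c * v i

  sumFin-cong : ∀ {m} {f g : Vec' m} → f ≗ g → sumFin f ≡ sumFin g
  sumFin-cong {zero}  f≗g = refl
  sumFin-cong {suc m} f≗g = cong₂ _+_ (f≗g zero) (sumFin-cong (f≗g ∘ suc))

  sumFin-+ : ∀ {m} (f g : Vec' m) → sumFin (λ i → f i + g i) ≡ sumFin f + sumFin g
  sumFin-+ {zero}  f g = refl
  sumFin-+ {suc m} f g = trans (cong ((f zero + g zero) +_) (sumFin-+ (f ∘ suc) (g ∘ suc)))
    (+-interchange (f zero) (g zero) _ _)

  sumFin-• : ∀ {m} c (f : Vec' m) → sumFin (c • f) ≡ c * sumFin f
  sumFin-• {zero}  c f = sym (*-zeroʳ c)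
  sumFin-• {suc m} c f = trans (cong (c * f zero +_) (sumFin-• c (f ∘ suc)))
    (sym (*-distribˡ-+ c _ _))

  sumFin-zero : ∀ m → sumFin {m} (λ _ → 0ℚ) ≡ 0ℚ
  sumFin-zero zero    = refl
  sumFin-zero (suc m) = trans (+-identityˡ _) (sumFin-zero m)

  sumFin-swap : ∀ {m k} (h : Fin m → Fin k → ℚ) →
    sumFin (λ i → sumFin (h i)) ≡ sumFin (λ j → sumFin (λ i → h i j))
  sumFin-swap {zero}  {k} h = sym (sumFin-zero k)
  sumFin-swap {suc m} h = trans (cong (sumFin (h zero) +_) (sumFin-swap (h ∘ suc)))
    (sym (sumFin-+ (h zero) _))

  sumFin-idM : ∀ {m} (i : Fin m) (v : Vec' m) → sumFin (λ j → idM i j * v j) ≡ v i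
  sumFin-idM zero v = begin
    1ℚ * v zero + sumFin (λ j → 0ℚ * v (suc j))
      ≡⟨ cong₂ _+_ (*-identityˡ (v zero)) (trans (sumFin-• 0ℚ (v ∘ suc)) (*-zeroˡ (sumFin (v ∘ suc)))) ⟩
    v zero + 0ℚ  ≡⟨ +-identityʳ _ ⟩
    v zero       ∎
    where open ≡-Reasoning
  sumFin-idM (suc i) v = trans (cong₂ _+_ (*-zeroˡ (v zero)) (sumFin-idM i (v ∘ suc))) (+-identityˡ _)

  sumFin-const : ∀ m c → sumFin {m} (λ _ → c) ≡ nat m * c
  sumFin-const zero    c = sym (*-zeroˡ c)
  sumFin-const (suc m) c = begin
    c + sumFin {m} (λ _ → c)  ≡⟨ cong (c +_) (sumFin-const m c) ⟩
    c + nat m * c             ≡⟨ cong (_+ nat m * c) (sym (*-identityˡ c)) ⟩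
    1ℚ * c + nat m * c        ≡⟨ sym (*-distribʳ-+ c 1ℚ (nat m)) ⟩
    (1ℚ + nat m) * c          ≡⟨ cong (_* c) (sym (nat-+ 1 m)) ⟩
    nat (suc m) * c           ∎
    where open ≡-Reasoning

  module _ {a b : ℕ} where

    ·-congʳ : (A : Mat a b) {v w : Vec' b} → v ≗ w → A · v ≗ A · w
    ·-congʳ A v≗w i = sumFin-cong (λ k → cong (A i k *_) (v≗w k))

    ·-congˡ : {A B : Mat a b} (v : Vec' b) → MatEq A B → A · v ≗ B · v
    ·-congˡ v A≡B i = sumFin-cong (λ k → cong (_* v k) (A≡B i k))

    ·-• : (A : Mat a b) (c : ℚ) (v : Vec' b) → A · (c • v) ≗ c • (A · v)
    ·-• A c v i = trans (sumFin-cong (λ k → *-left-comm (A i k) c (v k))) (sumFin-• c (λ k → A i k * v k))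

    ·-+ : (A : Mat a b) (u v : Vec' b) → A · (λ k → u k + v k) ≗ λ i → (A · u) i + (A · v) i
    ·-+ A u v i = trans (sumFin-cong (λ k → *-distribˡ-+ (A i k) (u k) (v k))) (sumFin-+ (λ k → A i k * u k) (λ k → A i k * v k))

  ·-assoc : ∀ {a b c} (A : Mat a b) (B : Mat b c) (v : Vec' c) → (A ⊗ B) · v ≗ A · (B · v)
  ·-assoc A B v i = begin
    sumFin (λ k → sumFin (λ l → A i l * B l k) * v k)   ≡⟨ sumFin-cong (λ k → *-comm (sumFin (λ l → A i l * B l k)) (v k)) ⟩
    sumFin (λ k → v k * sumFin (λ l → A i l * B l k))   ≡⟨ sumFin-cong (λ k → sym (sumFin-• (v k) (λ l → A i l * B l k))) ⟩
    sumFin (λ k → sumFin (λ l → v k * (A i l * B l k))) ≡⟨ sumFin-swap (λ k l → v k * (A i l * B l k)) ⟩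
    sumFin (λ l → sumFin (λ k → v k * (A i l * B l k))) ≡⟨ sumFin-cong (λ l → sumFin-cong (λ k → *-rotate (v k) (A i l) (B l k))) ⟩
    sumFin (λ l → sumFin (λ k → A i l * (B l k * v k))) ≡⟨ sumFin-cong (λ l → sumFin-• (A i l) (λ k → B l k * v k)) ⟩
    sumFin (λ l → A i l * sumFin (λ k → B l k * v k))   ∎
    where open ≡-Reasoning

  ⊗-assoc : ∀ {a b c d} (A : Mat a b) (B : Mat b c) (C : Mat c d) → MatEq ((A ⊗ B) ⊗ C) (A ⊗ (B ⊗ C))
  ⊗-assoc A B C i j = ·-assoc A B (λ k → C k j) i

  transpose-⊗ : ∀ {a b c} (A : Mat a b) (B : Mat b c) → MatEq (transpose (A ⊗ B)) (transpose B ⊗ transpose A)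
  transpose-⊗ A B i j = sumFin-cong (λ k → *-comm (A j k) (B k i))

  ⊗-cong : ∀ {a b c} {A A′ : Mat a b} {B B′ : Mat b c} → MatEq A A′ → MatEq B B′ → MatEq (A ⊗ B) (A′ ⊗ B′)
  ⊗-cong A≡A′ B≡B′ i j = sumFin-cong (λ k → cong₂ _*_ (A≡A′ i k) (B≡B′ k j))

  scale-· : ∀ {a b} (c : ℚ) (A : Mat a b) (v : Vec' b) → (λ i j → c * A i j) · v ≗ c • (A · v)
  scale-· c A v i = trans (sumFin-cong (λ k → *-assoc c (A i k) (v k))) (sumFin-• c (λ k → A i k * v k))

  sandwich-· : ∀ {m} (A B : Mat m m) (v : Vec' m) → ((A ⊗ B) ⊗ A) · v ≗ A · (B · (A · v))
  sandwich-· A B v i = trans (·-assoc (A ⊗ B) A v i) (·-assoc A B (A · v) i)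

  IsSymmetric : ∀ {m} → Mat m m → Set
  IsSymmetric A = MatEq (transpose A) A

  sandwich-symmetric : ∀ {m} {A B : Mat m m} → IsSymmetric A → IsSymmetric B → IsSymmetric ((A ⊗ B) ⊗ A)
  sandwich-symmetric {A = A} {B} A-sym B-sym i j = begin
    ((A ⊗ B) ⊗ A) j i                     ≡⟨ transpose-⊗ (A ⊗ B) A i j ⟩
    (transpose A ⊗ transpose (A ⊗ B)) i j ≡⟨ ⊗-cong A-sym (λ k l → trans (transpose-⊗ A B k l) (⊗-cong B-sym A-sym k l)) i j ⟩
    (A ⊗ (B ⊗ A)) i j                     ≡⟨ sym (⊗-assoc A B A i j) ⟩
    ((A ⊗ B) ⊗ A) i j                     ∎
    where open ≡-Reasoning

  module _ {N} {A X : Mat N N} (A-sym : IsSymmetric A) (mp : IsMoorePenrose A X)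
           {κ : ℚ} {y : Vec' N} (A·κy≗y : A · (κ • y) ≗ y) where
    open IsMoorePenrose mp
    open ≡-Reasoning

    private
      y≗A·κy : y ≗ A · (κ • y)
      y≗A·κy = sym ∘ A·κy≗y

      A·X·y≗y : A · (X · y) ≗ y
      A·X·y≗y i = begin
        (A · (X · y)) i               ≡⟨ ·-congʳ A (·-congʳ X y≗A·κy) i ⟩
        (A · (X · (A · (κ • y)))) i   ≡⟨ sym (·-assoc A X _ i) ⟩
        ((A ⊗ X) · (A · (κ • y))) i   ≡⟨ sym (·-assoc (A ⊗ X) A (κ • y) i) ⟩
        (((A ⊗ X) ⊗ A) · (κ • y)) i   ≡⟨ ·-congˡ (κ • y) penrose₁ i ⟩
        (A · (κ • y)) i               ≡⟨ A·κy≗y i ⟩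
        y i                           ∎

      XᵀA≡AX : MatEq (transpose X ⊗ A) (A ⊗ X)
      XᵀA≡AX i j = trans (sumFin-cong (λ k → trans (*-comm (X k i) (A k j)) (cong (_* X k i) (A-sym j k))))
                         (penrose₃ i j)

      XA≡AXᵀ : MatEq (X ⊗ A) (A ⊗ transpose X)
      XA≡AXᵀ i j = trans (sym (penrose₄ i j))
                         (sumFin-cong (λ k → trans (*-comm (X j k) (A k i)) (cong (_* X j k) (A-sym i k))))

      Xᵀ·y≗κy : transpose X · y ≗ κ • y
      Xᵀ·y≗κy i = begin
        (transpose X · y) i             ≡⟨ ·-congʳ (transpose X) y≗A·κy i ⟩
        (transpose X · (A · (κ • y))) i ≡⟨ sym (·-assoc (transpose X) A (κ • y) i) ⟩
        ((transpose X ⊗ A) · (κ • y)) i ≡⟨ ·-congˡ (κ • y) XᵀA≡AX i ⟩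
        ((A ⊗ X) · (κ • y)) i           ≡⟨ ·-assoc A X (κ • y) i ⟩
        (A · (X · (κ • y))) i           ≡⟨ ·-congʳ A (·-• X κ y) i ⟩
        (A · (κ • (X · y))) i           ≡⟨ ·-• A κ (X · y) i ⟩
        κ * (A · (X · y)) i             ≡⟨ cong (κ *_) (A·X·y≗y i) ⟩
        κ * y i                         ∎

    moorePenrose-eigenvector : X · y ≗ κ • y
    moorePenrose-eigenvector i = begin
      (X · y) i                       ≡⟨ ·-congʳ X y≗A·κy i ⟩
      (X · (A · (κ • y))) i           ≡⟨ sym (·-assoc X A (κ • y) i) ⟩
      ((X ⊗ A) · (κ • y)) i           ≡⟨ ·-congˡ (κ • y) XA≡AXᵀ i ⟩
      ((A ⊗ transpose X) · (κ • y)) i ≡⟨ ·-assoc A (transpose X) (κ • y) i ⟩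
      (A · (transpose X · (κ • y))) i ≡⟨ ·-congʳ A (·-• (transpose X) κ y) i ⟩
      (A · (κ • (transpose X · y))) i ≡⟨ ·-• A κ (transpose X · y) i ⟩
      κ * (A · (transpose X · y)) i   ≡⟨ cong (κ *_) (·-congʳ A Xᵀ·y≗κy i) ⟩
      κ * (A · (κ • y)) i             ≡⟨ cong (κ *_) (A·κy≗y i) ⟩
      κ * y i                         ∎

  -- P n unfolds to centring (dim n).
  centring : (N : ℕ) → Mat N N
  centring N i j = idM i j - frac (ℤ.+ 1) N

  centring-symmetric : ∀ N → IsSymmetric (centring N)
  centring-symmetric N i j = cong (λ b → (if b then 1ℚ else 0ℚ) - frac (ℤ.+ 1) N) (≡ᵇ-comm (toℕ j) (toℕ i))

  centring-· : ∀ {N} (v : Vec' N) i → (centring N · v) i ≡ v i - frac (ℤ.+ 1) N * sumFin v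
  centring-· {N} v i = begin
    sumFin (λ k → (idM i k + - f) * v k)             ≡⟨ sumFin-cong (λ k → *-distribʳ-+ (v k) (idM i k) (- f)) ⟩
    sumFin (λ k → idM i k * v k + - f * v k)         ≡⟨ sumFin-+ (λ k → idM i k * v k) ((- f) • v) ⟩
    sumFin (λ k → idM i k * v k) + sumFin ((- f) • v)  ≡⟨ cong₂ _+_ (sumFin-idM i v) (sumFin-• (- f) v) ⟩
    v i + - f * sumFin v                             ≡⟨ cong (v i +_) (sym (neg-distribˡ-* f (sumFin v))) ⟩
    v i - f * sumFin v                               ∎
    where
    open ≡-Reasoning
    f = frac (ℤ.+ 1) N

  centring-fixes-centred : ∀ {N} {v : Vec' N} → sumFin v ≡ 0ℚ → centring N · v ≗ v
  centring-fixes-centred {N} {v} Σv≡0 i = begin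
    (centring N · v) i                   ≡⟨ centring-· v i ⟩
    v i - frac (ℤ.+ 1) N * sumFin v      ≡⟨ cong (λ t → v i - frac (ℤ.+ 1) N * t) Σv≡0 ⟩
    v i - frac (ℤ.+ 1) N * 0ℚ            ≡⟨ cong (λ t → v i - t) (*-zeroʳ (frac (ℤ.+ 1) N)) ⟩
    v i - 0ℚ                             ≡⟨ +-identityʳ (v i) ⟩
    v i                                  ∎
    where open ≡-Reasoning

  centring-kills-constants : ∀ {N} (c : ℚ) → centring N · (λ _ → c) ≗ λ _ → 0ℚ
  centring-kills-constants {suc d} c i = begin
    (centring (suc d) · (λ _ → c)) i    ≡⟨ centring-· (λ _ → c) i ⟩
    c - f * sumFin {suc d} (λ _ → c)    ≡⟨ cong (λ t → c - f * t) (sumFin-const (suc d) c) ⟩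
    c - f * (nat (suc d) * c)           ≡⟨ cong (λ t → c - t) (sym (*-assoc f (nat (suc d)) c)) ⟩
    c - f * nat (suc d) * c             ≡⟨ cong (λ t → c - t * c) (trans (*-comm f _) (nat*frac≡1 d)) ⟩
    c - 1ℚ * c                          ≡⟨ cong (λ t → c - t) (*-identityˡ c) ⟩
    c - c                               ≡⟨ +-inverseʳ c ⟩
    0ℚ                                  ∎
    where
    open ≡-Reasoning
    f = frac (ℤ.+ 1) (suc d)

  centring-affine : ∀ {N} (c e : ℚ) (v : Vec' N) → centring N · (λ k → c * v k + e) ≗ c • (centring N · v)
  centring-affine {N} c e v i = begin
    (centring N · (λ k → c * v k + e)) i                     ≡⟨ ·-+ (centring N) (c • v) (λ _ → e) i ⟩
    (centring N · (c • v)) i + (centring N · (λ _ → e)) i    ≡⟨ cong₂ _+_ (·-• (centring N) c v i) (centring-kills-constants e i) ⟩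
    c * (centring N · v) i + 0ℚ                              ≡⟨ +-identityʳ _ ⟩
    c * (centring N · v) i                                   ∎
    where open ≡-Reasoning

  sumTo : ℕ → (ℕ → ℚ) → ℚ
  sumTo m g = sumFin {m} (λ i → g (toℕ i))

  sumTo-cong : ∀ m {g h : ℕ → ℚ} → (∀ k → k ℕ.< m → g k ≡ h k) → sumTo m g ≡ sumTo m h
  sumTo-cong m g≡h = sumFin-cong (λ i → g≡h (toℕ i) (toℕ<n i))

  sumTo-+ : ∀ a b (g : ℕ → ℚ) → sumTo (a ℕ.+ b) g ≡ sumTo a g + sumTo b (λ k → g (a ℕ.+ k))
  sumTo-+ zero    b g = sym (+-identityˡ _)
  sumTo-+ (suc a) b g = trans (cong (g 0 +_) (sumTo-+ a b (g ∘ suc)))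
    (sym (+-assoc (g 0) (sumTo a (g ∘ suc)) _))

  sumTo-*ʳ : ∀ m (g : ℕ → ℚ) c → sumTo m (λ k → g k * c) ≡ sumTo m g * c
  sumTo-*ʳ m g c = trans (sumFin-cong {m} (λ i → *-comm (g (toℕ i)) c))
    (trans (sumFin-• c (λ (i : Fin m) → g (toℕ i))) (*-comm c (sumTo m g)))

  sumTo-snoc : ∀ m (g : ℕ → ℚ) → sumTo (suc m) g ≡ sumTo m g + g m
  sumTo-snoc zero    g = trans (+-identityʳ (g 0)) (sym (+-identityˡ (g 0)))
  sumTo-snoc (suc m) g = trans (cong (g 0 +_) (sumTo-snoc m (g ∘ suc)))
    (sym (+-assoc (g 0) (sumTo m (g ∘ suc)) (g (suc m))))

  sumTo-reverse : ∀ m (g : ℕ → ℚ) → sumTo m (λ k → g (m ℕ.∸ suc k)) ≡ sumTo m g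
  sumTo-reverse zero    g = refl
  sumTo-reverse (suc m) g = begin
    g m + sumTo m (λ k → g (m ℕ.∸ suc k))  ≡⟨ cong (g m +_) (sumTo-reverse m g) ⟩
    g m + sumTo m g                        ≡⟨ +-comm (g m) (sumTo m g) ⟩
    sumTo m g + g m                        ≡⟨ sym (sumTo-snoc m g) ⟩
    sumTo (suc m) g                        ∎
    where open ≡-Reasoning

  indicator-head : ∀ u v N → u + N * v ≡ (nat 1 + N) * v + (u - v)
  indicator-head = solve-∀ ℚ-ring

  indicator-tail : ∀ u v N → v + (N * v + (u - v)) ≡ (nat 1 + N) * v + (u - v)
  indicator-tail = solve-∀ ℚ-ring

  sumTo-indicator : ∀ q a (u v : ℚ) → a ℕ.< q → sumTo q (λ b → if a ℕ.≡ᵇ b then u else v) ≡ nat q * v + (u - v)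
  sumTo-indicator (suc q) zero    u v _ = begin
    u + sumTo q (λ _ → v)     ≡⟨ cong (u +_) (sumFin-const q v) ⟩
    u + nat q * v             ≡⟨ indicator-head u v (nat q) ⟩
    (nat 1 + nat q) * v + (u - v)  ≡⟨ cong (λ t → t * v + (u - v)) (sym (nat-+ 1 q)) ⟩
    nat (suc q) * v + (u - v) ∎
    where open ≡-Reasoning
  sumTo-indicator (suc q) (suc a) u v (ℕ.s≤s a<q) = begin
    v + sumTo q (λ b → if a ℕ.≡ᵇ b then u else v)  ≡⟨ cong (v +_) (sumTo-indicator q a u v a<q) ⟩
    v + (nat q * v + (u - v))                      ≡⟨ indicator-tail u v (nat q) ⟩
    (nat 1 + nat q) * v + (u - v)                  ≡⟨ cong (λ t → t * v + (u - v)) (sym (nat-+ 1 q)) ⟩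
    nat (suc q) * v + (u - v)                      ∎
    where open ≡-Reasoning

  circOff-≤ : ∀ q {i j} → i ℕ.≤ j → circOff q i j ≡ j ℕ.∸ i
  circOff-≤ q i≤j = if-cong (≤ᵇ-true i≤j)

  circOff-> : ∀ q {i j} → j ℕ.< i → circOff q i j ≡ j ℕ.+ q ℕ.∸ i
  circOff-> q j<i = if-cong (≤ᵇ-false j<i)

  circOff-rowSum : ∀ q a (h : ℕ → ℚ) → a ℕ.≤ q → sumTo q (λ j → h (circOff q a j)) ≡ sumTo q h
  circOff-rowSum q a h a≤q with ℕ.m≤n⇒∃[o]m+o≡n a≤q
  ... | r , refl = begin
    sumTo (a ℕ.+ r) (h ∘ circOff (a ℕ.+ r) a)                                  ≡⟨ sumTo-+ a r (h ∘ circOff (a ℕ.+ r) a) ⟩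
    sumTo a (h ∘ circOff (a ℕ.+ r) a) + sumTo r (h ∘ circOff (a ℕ.+ r) a ∘ (a ℕ.+_))
      ≡⟨ cong₂ _+_ (sumTo-cong a (λ j j<a → cong h (trans (circOff-> (a ℕ.+ r) j<a) (wrap j))))
                   (sumTo-cong r (λ k _ → cong h (trans (circOff-≤ (a ℕ.+ r) (ℕ.m≤m+n a k)) (ℕ.m+n∸m≡n a k)))) ⟩
    sumTo a (λ j → h (r ℕ.+ j)) + sumTo r h                                   ≡⟨ +-comm _ (sumTo r h) ⟩
    sumTo r h + sumTo a (λ j → h (r ℕ.+ j))                                   ≡⟨ sym (sumTo-+ r a h) ⟩
    sumTo (r ℕ.+ a) h                                                         ≡⟨ cong (λ k → sumTo k h) (ℕ.+-comm r a) ⟩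
    sumTo (a ℕ.+ r) h                                                         ∎
    where
    open ≡-Reasoning
    wrap : ∀ j → j ℕ.+ (a ℕ.+ r) ℕ.∸ a ≡ r ℕ.+ j
    wrap j = trans (cong (ℕ._∸ a) (trans (ℕ.+-comm j (a ℕ.+ r)) (ℕ.+-assoc a r j))) (ℕ.m+n∸m≡n a (r ℕ.+ j))

  circOff-colSum : ∀ q a (h : ℕ → ℚ) → a ℕ.< q → sumTo q (λ b → h (circOff q b a)) ≡ sumTo q h
  circOff-colSum q a h a<q with ℕ.m≤n⇒∃[o]m+o≡n a<q
  ... | r , refl = begin
    sumTo (suc a ℕ.+ r) G                                    ≡⟨ sumTo-+ (suc a) r G ⟩
    sumTo (suc a) G + sumTo r (G ∘ (suc a ℕ.+_))
      ≡⟨ cong₂ _+_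
           (trans (sumTo-cong (suc a) (λ b b≤a → cong h (circOff-≤ (suc a ℕ.+ r) (ℕ.≤-pred b≤a))))
                  (sumTo-reverse (suc a) h))
           (trans (sumTo-cong r (λ k k<r → cong h (wrap k k<r)))
                  (sumTo-reverse r (h ∘ (suc a ℕ.+_)))) ⟩
    sumTo (suc a) h + sumTo r (h ∘ (suc a ℕ.+_))             ≡⟨ sym (sumTo-+ (suc a) r h) ⟩
    sumTo (suc a ℕ.+ r) h                                    ∎
    where
    open ≡-Reasoning
    G : ℕ → ℚ
    G b = h (circOff (suc a ℕ.+ r) b a)
    rearrange : ∀ a k t → a ℕ.+ (suc a ℕ.+ (suc k ℕ.+ t)) ≡ (suc a ℕ.+ k) ℕ.+ (suc a ℕ.+ t)
    rearrange = ℕ-solve-∀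
    wrap : ∀ k → k ℕ.< r → circOff (suc a ℕ.+ r) (suc a ℕ.+ k) a ≡ suc a ℕ.+ (r ℕ.∸ suc k)
    wrap k k<r with ℕ.m≤n⇒∃[o]m+o≡n k<r
    ... | t , refl = begin
      circOff (suc a ℕ.+ r) (suc a ℕ.+ k) a               ≡⟨ circOff-> (suc a ℕ.+ r) (ℕ.s≤s (ℕ.m≤m+n a k)) ⟩
      a ℕ.+ (suc a ℕ.+ (suc k ℕ.+ t)) ℕ.∸ (suc a ℕ.+ k)  ≡⟨ cong (ℕ._∸ (suc a ℕ.+ k)) (rearrange a k t) ⟩
      (suc a ℕ.+ k) ℕ.+ (suc a ℕ.+ t) ℕ.∸ (suc a ℕ.+ k)  ≡⟨ ℕ.m+n∸m≡n (suc a ℕ.+ k) (suc a ℕ.+ t) ⟩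
      suc a ℕ.+ t                                        ≡⟨ cong (suc a ℕ.+_) (sym (ℕ.m+n∸m≡n (suc k) t)) ⟩
      suc a ℕ.+ (suc k ℕ.+ t ℕ.∸ suc k)                  ∎

  circOff-flip : ∀ q {i j} → i ℕ.< j → circOff q j i ≡ q ℕ.∸ circOff q i j
  circOff-flip q {i} {j} i<j with ℕ.m≤n⇒∃[o]m+o≡n (ℕ.<⇒≤ i<j)
  ... | d , refl = begin
    circOff q (i ℕ.+ d) i           ≡⟨ circOff-> q i<j ⟩
    i ℕ.+ q ℕ.∸ (i ℕ.+ d)           ≡⟨ ℕ.[m+n]∸[m+o]≡n∸o i q d ⟩
    q ℕ.∸ d                         ≡⟨ cong (q ℕ.∸_) (sym (ℕ.m+n∸m≡n i d)) ⟩
    q ℕ.∸ (i ℕ.+ d ℕ.∸ i)           ≡⟨ cong (q ℕ.∸_) (sym (circOff-≤ q (ℕ.<⇒≤ i<j))) ⟩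
    q ℕ.∸ circOff q i (i ℕ.+ d)     ∎
    where open ≡-Reasoning

  module _ (q : ℕ) (r : ℕ → ℚ) (palindrome : ∀ d → 0 ℕ.< d → d ℕ.< q → r d ≡ r (q ℕ.∸ d)) where

    private
      symmetric-< : ∀ {i j} → i ℕ.< j → j ℕ.< q → r (circOff q i j) ≡ r (circOff q j i)
      symmetric-< {i} {j} i<j j<q = trans (palindrome (circOff q i j) 0<d d<q) (cong r (sym (circOff-flip q i<j)))
        where
        d≡j∸i = circOff-≤ q (ℕ.<⇒≤ i<j)
        0<d = subst (0 ℕ.<_) (sym d≡j∸i) (ℕ.m<n⇒0<n∸m i<j)
        d<q = subst (ℕ._< q) (sym d≡j∸i) (ℕ.≤-<-trans (ℕ.m∸n≤m j i) j<q)

    circulant-symmetric : ∀ {i j} → i ℕ.< q → j ℕ.< q → r (circOff q i j) ≡ r (circOff q j i)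
    circulant-symmetric {i} {j} i<q j<q with ℕ.<-cmp i j
    ... | tri< i<j _ _ = symmetric-< i<j j<q
    ... | tri≈ _ refl _ = refl
    ... | tri> _ _ j<i = sym (symmetric-< j<i i<q)

  -- Rows of the quotient matrix of D for the partition {0}, {1,…,p}, {p+1,…,2p} (p = n - 1),
  -- namely (0, p, 2p), (1, 2p - 2, σ) and (2, σ, τ), where σ and τ are the row sums of S and T.
  quotient-hub : ℚ → ℚ → ℚ → ℚ → ℚ
  quotient-hub π a₀ a₁ a₂ = nat 0 * a₀ + (π * (nat 1 * a₁) + π * (nat 2 * a₂))

  quotient-inner : ℚ → ℚ → ℚ → ℚ → ℚ → ℚ
  quotient-inner π σ a₀ a₁ a₂ = nat 1 * a₀ + ((π * nat 2 + (nat 0 - nat 2)) * a₁ + σ * a₂)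

  quotient-outer : ℚ → ℚ → ℚ → ℚ → ℚ → ℚ
  quotient-outer σ τ a₀ a₁ a₂ = nat 2 * a₀ + (σ * a₁ + τ * a₂)

  -- With x = n - 4 and w = 1/(3(n - 1)), y is w (3(n - 1), n - 2, -(n + 1)) on the three classes,
  -- and these are the rows of (2n - 1) Q y = (n + 4) (-2 y + c 𝟙) together with 𝟙'y = 0.
  gear-quotient-hub : ∀ x w →
    let π = nat 3 + x
        a₀ = nat 3 * π * w ; a₁ = (nat 2 + x) * w ; a₂ = - ((nat 4 + x + nat 1) * w)
    in (nat 1 + (π + π)) * (nat 0 * a₀ + (π * (nat 1 * a₁) + π * (nat 2 * a₂)))
       ≡ (nat 4 + x + nat 4) * (- nat 2 * a₀ + - ((nat 1 + nat 2 * x) * π * w))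
  gear-quotient-hub = solve-∀ ℚ-ring

  gear-quotient-inner : ∀ x w →
    let π = nat 3 + x ; σ = nat 1 + ((nat 1 + x) * nat 3 + nat 1)
        a₀ = nat 3 * π * w ; a₁ = (nat 2 + x) * w ; a₂ = - ((nat 4 + x + nat 1) * w)
    in (nat 1 + (π + π)) * (nat 1 * a₀ + ((π * nat 2 + (nat 0 - nat 2)) * a₁ + σ * a₂))
       ≡ (nat 4 + x + nat 4) * (- nat 2 * a₁ + - ((nat 1 + nat 2 * x) * π * w))
  gear-quotient-inner = solve-∀ ℚ-ring

  gear-quotient-outer : ∀ x w →
    let π = nat 3 + x ; σ = nat 1 + ((nat 1 + x) * nat 3 + nat 1) ; τ = nat 0 + (nat 2 + (x * nat 4 + nat 2))
        a₀ = nat 3 * π * w ; a₁ = (nat 2 + x) * w ; a₂ = - ((nat 4 + x + nat 1) * w)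
    in (nat 1 + (π + π)) * (nat 2 * a₀ + (σ * a₁ + τ * a₂))
       ≡ (nat 4 + x + nat 4) * (- nat 2 * a₂ + - ((nat 1 + nat 2 * x) * π * w))
  gear-quotient-outer = solve-∀ ℚ-ring

  gear-centred : ∀ x w →
    let π = nat 3 + x
    in nat 3 * π * w + (π * ((nat 2 + x) * w) + π * - ((nat 4 + x + nat 1) * w)) ≡ 0ℚ
  gear-centred = solve-∀ ℚ-ring

  half-cancels : ∀ t → - frac (ℤ.+ 1) 2 * (- nat 2 * t) ≡ t
  half-cancels = solve-∀ ℚ-ring

  scale-by-inverse : ∀ {K L g q r : ℚ} → L * g ≡ 1ℚ → K * q ≡ L * r → K * g * q ≡ r
  scale-by-inverse {K} {L} {g} {q} {r} Lg≡1 Kq≡Lr = begin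
    K * g * q      ≡⟨ *-xy∙z≈y∙xz K g q ⟩
    g * (K * q)    ≡⟨ cong (g *_) Kq≡Lr ⟩
    g * (L * r)    ≡⟨ *-x∙yz≈yx∙z g L r ⟩
    L * g * r      ≡⟨ cong (_* r) Lg≡1 ⟩
    1ℚ * r         ≡⟨ *-identityˡ r ⟩
    r              ∎
    where open ≡-Reasoning

  -- The gear graph with n = 4 + m; its vertex classes are the index 0, the indices suc a, and the
  -- indices suc (p + j), for a, j < p.
  module Gear (m : ℕ) where

    n p : ℕ
    n = 4 ℕ.+ m
    p = 3 ℕ.+ m

    dim≡ : dim n ≡ suc (p ℕ.+ p)
    dim≡ = cong (ℕ._∸ 1) (double m)
      where
      double : ∀ m → 2 ℕ.* (4 ℕ.+ m) ≡ 2 ℕ.+ ((3 ℕ.+ m) ℕ.+ (3 ℕ.+ m))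
      double = ℕ-solve-∀

    sumTo-dim : ∀ (g : ℕ → ℚ) → sumTo (dim n) g ≡ g 0 + (sumTo p (g ∘ suc) + sumTo p (λ j → g (suc (p ℕ.+ j))))
    sumTo-dim g = trans (cong (λ k → sumTo k g) dim≡) (cong (g 0 +_) (sumTo-+ p p (g ∘ suc)))

    inner<n : ∀ {a} → a ℕ.< p → (suc a ℕ.<ᵇ n) ≡ true
    inner<n a<p = <ᵇ-true (ℕ.s≤s a<p)

    outer≮n : ∀ j → (suc (p ℕ.+ j) ℕ.<ᵇ n) ≡ false
    outer≮n j = <ᵇ-false (ℕ.s≤s (ℕ.m≤m+n p j))

    D-hub-inner : ∀ {a} → a ℕ.< p → Dₑ n 0 (suc a) ≡ nat 1
    D-hub-inner a<p = if-cong (inner<n a<p)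

    D-hub-outer : ∀ j → Dₑ n 0 (suc (p ℕ.+ j)) ≡ nat 2
    D-hub-outer j = if-cong (outer≮n j)

    D-inner-inner : ∀ {a b} → a ℕ.< p → b ℕ.< p → Dₑ n (suc a) (suc b) ≡ (if a ℕ.≡ᵇ b then nat 0 else nat 2)
    D-inner-inner a<p b<p = trans (if-cong (inner<n a<p)) (if-cong (inner<n b<p))

    D-inner-outer : ∀ {a} j → a ℕ.< p → Dₑ n (suc a) (suc (p ℕ.+ j)) ≡ sRow n (circOff p a j)
    D-inner-outer {a} j a<p = trans (if-cong (inner<n a<p))
      (trans (if-cong (outer≮n j)) (cong (sRow n ∘ circOff p a) (ℕ.m+n∸m≡n p j)))

    D-outer-inner : ∀ j {b} → b ℕ.< p → Dₑ n (suc (p ℕ.+ j)) (suc b) ≡ sRow n (circOff p b j)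
    D-outer-inner j {b} b<p = trans (if-cong (outer≮n j))
      (trans (if-cong (inner<n b<p)) (cong (sRow n ∘ circOff p b) (ℕ.m+n∸m≡n p j)))

    D-outer-outer : ∀ j k → Dₑ n (suc (p ℕ.+ j)) (suc (p ℕ.+ k)) ≡ tRow n (circOff p j k)
    D-outer-outer j k = trans (if-cong (outer≮n j))
      (trans (if-cong (outer≮n k)) (cong₂ (λ a b → tRow n (circOff p a b)) (ℕ.m+n∸m≡n p j) (ℕ.m+n∸m≡n p k)))

    x : ℚ
    x = nat m

    σS σT : ℚ
    σS = sumTo p (sRow n)
    σT = sumTo p (tRow n)

    σS≡ : σS ≡ nat 1 + ((nat 1 + x) * nat 3 + nat 1)
    σS≡ = cong (nat 1 +_) (begin
      sumTo (suc (suc m)) (sRow n ∘ ℕ.suc)                        ≡⟨ sumTo-snoc (suc m) (sRow n ∘ ℕ.suc) ⟩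
      sumTo (suc m) (sRow n ∘ ℕ.suc) + sRow n (suc (suc m))       ≡⟨ cong₂ _+_ middle (if-cong (≡ᵇ-true m)) ⟩
      nat (suc m) * nat 3 + nat 1                               ≡⟨ cong (λ t → t * nat 3 + nat 1) (nat-+ 1 m) ⟩
      (nat 1 + x) * nat 3 + nat 1                               ∎)
      where
      open ≡-Reasoning
      middle : sumTo (suc m) (sRow n ∘ ℕ.suc) ≡ nat (suc m) * nat 3
      middle = trans (sumTo-cong (suc m) {sRow n ∘ ℕ.suc} {λ _ → nat 3} (λ k k<1+m → if-cong (≡ᵇ-false (ℕ.<⇒≢ k<1+m))))
                     (sumFin-const (suc m) (nat 3))

    σT≡ : σT ≡ nat 0 + (nat 2 + (x * nat 4 + nat 2))
    σT≡ = cong (λ t → nat 0 + (nat 2 + t)) (begin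
      sumTo (suc m) (tRow n ∘ ℕ.suc ∘ ℕ.suc)                        ≡⟨ sumTo-snoc m (tRow n ∘ ℕ.suc ∘ ℕ.suc) ⟩
      sumTo m (tRow n ∘ ℕ.suc ∘ ℕ.suc) + tRow n (suc (suc m))       ≡⟨ cong₂ _+_ middle (if-cong (≡ᵇ-true m)) ⟩
      x * nat 4 + nat 2                                         ∎)
      where
      open ≡-Reasoning
      middle : sumTo m (tRow n ∘ ℕ.suc ∘ ℕ.suc) ≡ x * nat 4
      middle = trans (sumTo-cong m {tRow n ∘ ℕ.suc ∘ ℕ.suc} {λ _ → nat 4} (λ k k<m → if-cong (≡ᵇ-false (ℕ.<⇒≢ k<m))))
                     (sumFin-const m (nat 4))

    tRow-palindrome : ∀ d → 0 ℕ.< d → d ℕ.< p → tRow n d ≡ tRow n (p ℕ.∸ d)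
    tRow-palindrome 1 _ _ = sym (if-cong (≡ᵇ-true m))
    tRow-palindrome (suc (suc e)) _ (ℕ.s≤s (ℕ.s≤s (ℕ.s≤s e≤m))) with e ℕ.≟ m
    ... | yes refl = trans (if-cong (≡ᵇ-true m)) (cong (tRow n) (sym (ℕ.m+n∸n≡m 1 m)))
    ... | no e≢m = trans (if-cong (≡ᵇ-false e≢m)) (sym (trans (cong (tRow n) reflected) (if-cong (≡ᵇ-false (ℕ.<⇒≢ below-m)))))
      where
      e<m = ℕ.≤∧≢⇒< e≤m e≢m
      reflected : suc m ℕ.∸ e ≡ suc (suc (m ℕ.∸ suc e))
      reflected = trans (ℕ.+-∸-assoc 1 e≤m) (cong suc (ℕ.+-∸-assoc 1 e<m))
      below-m : m ℕ.∸ suc e ℕ.< m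
      below-m = ℕ.∸-monoʳ-< {m} {suc e} {0} (ℕ.s≤s ℕ.z≤n) e<m

    Dₑ-symmetric : ∀ a b → a ℕ.< dim n → b ℕ.< dim n → Dₑ n a b ≡ Dₑ n b a
    Dₑ-symmetric zero    zero    _ _ = refl
    Dₑ-symmetric zero    (suc b) _ _ = refl
    Dₑ-symmetric (suc a) zero    _ _ = refl
    Dₑ-symmetric (suc a) (suc b) a<dim b<dim with suc a ℕ.<ᵇ n | suc b ℕ.<ᵇ n
    ... | true  | true  = cong (λ t → if t then nat 0 else nat 2) (≡ᵇ-comm a b)
    ... | true  | false = refl
    ... | false | true  = refl
    ... | false | false = circulant-symmetric p (tRow n) tRow-palindrome (outer-index a<dim) (outer-index b<dim)
      where
      outer-index : ∀ {k} → k ℕ.< dim n → k ℕ.∸ n ℕ.< p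
      outer-index {k} k<dim = ℕ.m<n+o⇒m∸n<o k n (subst (k ℕ.<_) dim≡ k<dim)

    D-symmetric : IsSymmetric (D n)
    D-symmetric i j = Dₑ-symmetric (toℕ j) (toℕ i) (toℕ<n j) (toℕ<n i)

    block : ℚ → ℚ → ℚ → ℕ → ℚ
    block a₀ a₁ a₂ zero    = a₀
    block a₀ a₁ a₂ (suc k) = if suc k ℕ.<ᵇ n then a₁ else a₂

    blockVec : ℚ → ℚ → ℚ → Vec' (dim n)
    blockVec a₀ a₁ a₂ i = block a₀ a₁ a₂ (toℕ i)

    blockVec-map : ∀ (f : ℚ → ℚ) a₀ a₁ a₂ i → f (blockVec a₀ a₁ a₂ i) ≡ blockVec (f a₀) (f a₁) (f a₂) i
    blockVec-map f a₀ a₁ a₂ i with toℕ i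
    ... | zero  = refl
    ... | suc k = if-float f (suc k ℕ.<ᵇ n)

    blockVec-cong : ∀ {a₀ a₁ a₂ b₀ b₁ b₂} → a₀ ≡ b₀ → a₁ ≡ b₁ → a₂ ≡ b₂ → blockVec a₀ a₁ a₂ ≗ blockVec b₀ b₁ b₂
    blockVec-cong refl refl refl i = refl

    module _ (a₀ a₁ a₂ : ℚ) where

      block-inner : ∀ {a} → a ℕ.< p → block a₀ a₁ a₂ (suc a) ≡ a₁
      block-inner a<p = if-cong (inner<n a<p)

      block-outer : ∀ j → block a₀ a₁ a₂ (suc (p ℕ.+ j)) ≡ a₂
      block-outer j = if-cong (outer≮n j)

      q₀ q₁ q₂ : ℚ
      q₀ = quotient-hub (nat p) a₀ a₁ a₂
      q₁ = quotient-inner (nat p) σS a₀ a₁ a₂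
      q₂ = quotient-outer σS σT a₀ a₁ a₂

      sum-blockVec : sumFin (blockVec a₀ a₁ a₂) ≡ a₀ + (nat p * a₁ + nat p * a₂)
      sum-blockVec = trans (sumTo-dim (block a₀ a₁ a₂)) (cong (a₀ +_) (cong₂ _+_
        (trans (sumTo-cong p (λ _ → block-inner)) (sumFin-const p a₁))
        (trans (sumTo-cong p (λ j _ → block-outer j)) (sumFin-const p a₂))))

      row : ℕ → ℚ
      row r = sumTo (dim n) (λ k → Dₑ n r k * block a₀ a₁ a₂ k)

      row-hub : row 0 ≡ q₀
      row-hub = trans (sumTo-dim (λ k → Dₑ n 0 k * block a₀ a₁ a₂ k)) (cong (nat 0 * a₀ +_) (cong₂ _+_
        (trans (sumTo-cong p (λ _ a<p → cong₂ _*_ (D-hub-inner a<p) (block-inner a<p))) (sumFin-const p _))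
        (trans (sumTo-cong p (λ j _ → cong₂ _*_ (D-hub-outer j) (block-outer j))) (sumFin-const p _))))

      row-inner : ∀ {a} → a ℕ.< p → row (suc a) ≡ q₁
      row-inner {a} a<p = trans (sumTo-dim (λ k → Dₑ n (suc a) k * block a₀ a₁ a₂ k))
        (cong₂ _+_ (cong (_* a₀) (if-cong (inner<n a<p))) (cong₂ _+_ from-inner from-outer))
        where
        open ≡-Reasoning
        from-inner : sumTo p (λ b → Dₑ n (suc a) (suc b) * block a₀ a₁ a₂ (suc b)) ≡ (nat p * nat 2 + (nat 0 - nat 2)) * a₁
        from-inner = begin
          sumTo p (λ b → Dₑ n (suc a) (suc b) * block a₀ a₁ a₂ (suc b))
            ≡⟨ sumTo-cong p (λ b b<p → cong₂ _*_ (D-inner-inner a<p b<p) (block-inner b<p)) ⟩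
          sumTo p (λ b → (if a ℕ.≡ᵇ b then nat 0 else nat 2) * a₁)
            ≡⟨ sumTo-*ʳ p (λ b → if a ℕ.≡ᵇ b then nat 0 else nat 2) a₁ ⟩
          sumTo p (λ b → if a ℕ.≡ᵇ b then nat 0 else nat 2) * a₁
            ≡⟨ cong (_* a₁) (sumTo-indicator p a (nat 0) (nat 2) a<p) ⟩
          (nat p * nat 2 + (nat 0 - nat 2)) * a₁  ∎
        from-outer : sumTo p (λ j → Dₑ n (suc a) (suc (p ℕ.+ j)) * block a₀ a₁ a₂ (suc (p ℕ.+ j))) ≡ σS * a₂
        from-outer = begin
          sumTo p (λ j → Dₑ n (suc a) (suc (p ℕ.+ j)) * block a₀ a₁ a₂ (suc (p ℕ.+ j)))
            ≡⟨ sumTo-cong p (λ j _ → cong₂ _*_ (D-inner-outer j a<p) (block-outer j)) ⟩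
          sumTo p (λ j → sRow n (circOff p a j) * a₂)
            ≡⟨ sumTo-*ʳ p (sRow n ∘ circOff p a) a₂ ⟩
          sumTo p (sRow n ∘ circOff p a) * a₂
            ≡⟨ cong (_* a₂) (circOff-rowSum p a (sRow n) (ℕ.<⇒≤ a<p)) ⟩
          σS * a₂  ∎

      row-outer : ∀ {j} → j ℕ.< p → row (suc (p ℕ.+ j)) ≡ q₂
      row-outer {j} j<p = trans (sumTo-dim (λ k → Dₑ n (suc (p ℕ.+ j)) k * block a₀ a₁ a₂ k))
        (cong₂ _+_ (cong (_* a₀) (if-cong (outer≮n j))) (cong₂ _+_ from-inner from-outer))
        where
        open ≡-Reasoning
        from-inner : sumTo p (λ b → Dₑ n (suc (p ℕ.+ j)) (suc b) * block a₀ a₁ a₂ (suc b)) ≡ σS * a₁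
        from-inner = begin
          sumTo p (λ b → Dₑ n (suc (p ℕ.+ j)) (suc b) * block a₀ a₁ a₂ (suc b))
            ≡⟨ sumTo-cong p (λ b b<p → cong₂ _*_ (D-outer-inner j b<p) (block-inner b<p)) ⟩
          sumTo p (λ b → sRow n (circOff p b j) * a₁)
            ≡⟨ sumTo-*ʳ p (λ b → sRow n (circOff p b j)) a₁ ⟩
          sumTo p (λ b → sRow n (circOff p b j)) * a₁
            ≡⟨ cong (_* a₁) (circOff-colSum p j (sRow n) j<p) ⟩
          σS * a₁  ∎
        from-outer : sumTo p (λ k → Dₑ n (suc (p ℕ.+ j)) (suc (p ℕ.+ k)) * block a₀ a₁ a₂ (suc (p ℕ.+ k))) ≡ σT * a₂
        from-outer = begin
          sumTo p (λ k → Dₑ n (suc (p ℕ.+ j)) (suc (p ℕ.+ k)) * block a₀ a₁ a₂ (suc (p ℕ.+ k)))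
            ≡⟨ sumTo-cong p (λ k _ → cong₂ _*_ (D-outer-outer j k) (block-outer k)) ⟩
          sumTo p (λ k → tRow n (circOff p j k) * a₂)
            ≡⟨ sumTo-*ʳ p (tRow n ∘ circOff p j) a₂ ⟩
          sumTo p (tRow n ∘ circOff p j) * a₂
            ≡⟨ cong (_* a₂) (circOff-rowSum p j (tRow n) (ℕ.<⇒≤ j<p)) ⟩
          σT * a₂  ∎

      D·blockVec : D n · blockVec a₀ a₁ a₂ ≗ blockVec q₀ q₁ q₂
      D·blockVec i = rows (toℕ i) (toℕ<n i)
        where
        rows : ∀ r → r ℕ.< dim n → row r ≡ block q₀ q₁ q₂ r
        rows zero    _     = row-hub
        rows (suc r) r<dim with r ℕ.<? p
        ... | yes r<p = trans (row-inner r<p) (sym (if-cong (inner<n r<p)))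
        ... | no  r≮p with ℕ.m≤n⇒∃[o]m+o≡n (ℕ.≮⇒≥ r≮p)
        ...   | j , refl = trans (row-outer j<p) (sym (if-cong (outer≮n j)))
          where j<p = ℕ.+-cancelˡ-< p j p (ℕ.≤-pred (subst (suc (p ℕ.+ j) ℕ.<_) dim≡ r<dim))

    π w g κ : ℚ
    π = nat 3 + x
    w = frac (ℤ.+ 1) (3 ℕ.* p)
    g = frac (ℤ.+ 1) (n ℕ.+ 4)
    κ = frac (ℤ.+ dim n) (n ℕ.+ 4)

    hubValue innerValue outerValue offset : ℚ
    hubValue   = nat 3 * π * w
    innerValue = (nat 2 + x) * w
    outerValue = - ((nat 4 + x + nat 1) * w)
    offset     = - ((nat 1 + nat 2 * x) * π * w)

    nat-p : nat p ≡ π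
    nat-p = nat-+ 3 m

    y≗blockVec : y n ≗ blockVec hubValue innerValue outerValue
    y≗blockVec i = trans (raw i) (blockVec-cong one inner outer i)
      where
      raw : y n ≗ blockVec 1ℚ (frac (ℤ.+ (n ℕ.∸ 2)) (3 ℕ.* p)) (- frac (ℤ.+ (n ℕ.+ 1)) (3 ℕ.* p))
      raw i with toℕ i
      ... | zero  = refl
      ... | suc k = refl
      one : 1ℚ ≡ hubValue
      one = sym (trans (cong (_* w) (sym (trans (nat-* 3 p) (cong (nat 3 *_) nat-p)))) (nat*frac≡1 (ℕ.pred (3 ℕ.* p))))
      inner : frac (ℤ.+ (n ℕ.∸ 2)) (3 ℕ.* p) ≡ innerValue
      inner = trans (frac-split (2 ℕ.+ m) (ℕ.pred (3 ℕ.* p))) (cong (_* w) (nat-+ 2 m))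
      outer : - frac (ℤ.+ (n ℕ.+ 1)) (3 ℕ.* p) ≡ outerValue
      outer = cong -_ (trans (frac-split (n ℕ.+ 1) (ℕ.pred (3 ℕ.* p))) (cong (_* w) (trans (nat-+ n 1) (cong (_+ nat 1) (nat-+ 4 m)))))

    κ*≡-cleared : ∀ {q q′ r} → q ≡ q′ → (nat 1 + (π + π)) * q′ ≡ (nat 4 + x + nat 4) * r → κ * q ≡ r
    κ*≡-cleared {q} {q′} {r} q≡q′ eq = begin
      κ * q                          ≡⟨ cong₂ _*_ κ≡ q≡q′ ⟩
      (nat 1 + (π + π)) * g * q′     ≡⟨ scale-by-inverse {nat 1 + (π + π)} {nat 4 + x + nat 4} {g} {q′} {r} Lg≡1 eq ⟩
      r                              ∎
      where
      open ≡-Reasoning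
      κ≡ : κ ≡ (nat 1 + (π + π)) * g
      κ≡ = trans (frac-split (dim n) (ℕ.pred (n ℕ.+ 4))) (cong (_* g)
        (trans (cong nat dim≡) (trans (nat-+ 1 (p ℕ.+ p)) (cong (nat 1 +_) (trans (nat-+ p p) (cong₂ _+_ nat-p nat-p))))))
      Lg≡1 : (nat 4 + x + nat 4) * g ≡ 1ℚ
      Lg≡1 = trans (cong (_* g) (sym (trans (nat-+ n 4) (cong (_+ nat 4) (nat-+ 4 m))))) (nat*frac≡1 (ℕ.pred (n ℕ.+ 4)))

    D·κy : D n · (κ • y n) ≗ λ k → - nat 2 * y n k + offset
    D·κy k = begin
      (D n · (κ • y n)) k                           ≡⟨ ·-• (D n) κ (y n) k ⟩
      κ * (D n · y n) k                             ≡⟨ cong (κ *_) (·-congʳ (D n) y≗blockVec k) ⟩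
      κ * (D n · blockVec a₀ a₁ a₂) k               ≡⟨ cong (κ *_) (D·blockVec a₀ a₁ a₂ k) ⟩
      κ * blockVec b₀ b₁ b₂ k                       ≡⟨ blockVec-map (κ *_) b₀ b₁ b₂ k ⟩
      blockVec (κ * b₀) (κ * b₁) (κ * b₂) k         ≡⟨ blockVec-cong κb₀≡ κb₁≡ κb₂≡ k ⟩
      blockVec (affine a₀) (affine a₁) (affine a₂) k ≡⟨ sym (blockVec-map affine a₀ a₁ a₂ k) ⟩
      affine (blockVec a₀ a₁ a₂ k)                  ≡⟨ cong affine (sym (y≗blockVec k)) ⟩
      affine (y n k)                                ∎
      where
      open ≡-Reasoning
      a₀ = hubValue ; a₁ = innerValue ; a₂ = outerValue
      b₀ = q₀ a₀ a₁ a₂ ; b₁ = q₁ a₀ a₁ a₂ ; b₂ = q₂ a₀ a₁ a₂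
      affine : ℚ → ℚ
      affine t = - nat 2 * t + offset
      κb₀≡ = κ*≡-cleared (cong (λ t → quotient-hub t a₀ a₁ a₂) nat-p) (gear-quotient-hub x w)
      κb₁≡ = κ*≡-cleared (cong₂ (λ t s → quotient-inner t s a₀ a₁ a₂) nat-p σS≡) (gear-quotient-inner x w)
      κb₂≡ = κ*≡-cleared (cong₂ (λ s t → quotient-outer s t a₀ a₁ a₂) σS≡ σT≡) (gear-quotient-outer x w)

    sum-y : sumFin (y n) ≡ 0ℚ
    sum-y = begin
      sumFin (y n)                                                 ≡⟨ sumFin-cong y≗blockVec ⟩
      sumFin (blockVec hubValue innerValue outerValue)             ≡⟨ sum-blockVec hubValue innerValue outerValue ⟩
      hubValue + (nat p * innerValue + nat p * outerValue)         ≡⟨ cong (λ t → hubValue + (t * innerValue + t * outerValue)) nat-p ⟩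
      hubValue + (π * innerValue + π * outerValue)                 ≡⟨ gear-centred x w ⟩
      0ℚ                                                           ∎
      where open ≡-Reasoning

    U-symmetric : IsSymmetric (U n)
    U-symmetric i j = cong (- frac (ℤ.+ 1) 2 *_) (sandwich-symmetric (centring-symmetric (dim n)) D-symmetric i j)

    U-eigen : U n · (κ • y n) ≗ y n
    U-eigen i = begin
      (U n · (κ • y n)) i                                ≡⟨ scale-· (- frac (ℤ.+ 1) 2) ((P n ⊗ D n) ⊗ P n) (κ • y n) i ⟩
      -½ * (((P n ⊗ D n) ⊗ P n) · (κ • y n)) i           ≡⟨ cong (-½ *_) (sandwich-· (P n) (D n) (κ • y n) i) ⟩
      -½ * (P n · (D n · (P n · (κ • y n)))) i
        ≡⟨ cong (-½ *_) (·-congʳ (P n) (·-congʳ (D n) (centring-fixes-centred {v = κ • y n} sum-κy)) i) ⟩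
      -½ * (P n · (D n · (κ • y n))) i                   ≡⟨ cong (-½ *_) (·-congʳ (P n) D·κy i) ⟩
      -½ * (P n · (λ k → - nat 2 * y n k + offset)) i    ≡⟨ cong (-½ *_) (centring-affine (- nat 2) offset (y n) i) ⟩
      -½ * (- nat 2 * (P n · y n) i)                     ≡⟨ cong (λ t → -½ * (- nat 2 * t)) (centring-fixes-centred {v = y n} sum-y i) ⟩
      -½ * (- nat 2 * y n i)                             ≡⟨ half-cancels (y n i) ⟩
      y n i                                              ∎
      where
      open ≡-Reasoning
      -½ = - frac (ℤ.+ 1) 2
      sum-κy : sumFin (κ • y n) ≡ 0ℚ
      sum-κy = trans (sumFin-• κ (y n)) (trans (cong (κ *_) sum-y) (*-zeroʳ κ))

open import Defs
open import Data.Nat using (ℕ; _≤_; _+_; _∸_)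
open import Data.Integer using (+_)
open import Data.Rational using (_*_)
open import Relation.Binary.PropositionalEquality using (_≡_)
open import Data.Nat.Divisibility using (_∣_)
open import Data.Nat using (suc; s≤s; z≤n)
open GearDistance using (moorePenrose-eigenvector; module Gear)

lemma4 : (n : ℕ) → 4 ≤ n → 2 ∣ n →
    (X : Mat (dim n) (dim n)) → IsMoorePenrose (U n) X →
    ∀ i → (X · y n) i ≡ frac (+ dim n) (n + 4) * y n i
lemma4 (suc (suc (suc (suc m)))) (s≤s (s≤s (s≤s (s≤s z≤n)))) _ X mp =
  moorePenrose-eigenvector (Gear.U-symmetric m) mp {Gear.κ m} (Gear.U-eigen m)
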